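{- Let $G=(V,E)$ be a finite connected graph of girth at least $7$, with $n$ vertices and $m$ edges, and let $\gamma(G)$ denote its domination number. Then either $\gamma(G)=1$ or $\gamma(G) \geq \frac{1}{2}\left(3+\sqrt{8(m-n)+9}\right)$. Moreover, if the minimum degree of $G$ is $2$, then $\gamma(G) \geq \max\left\{\sqrt{n}, \sqrt{\tfrac{2m}{3}}\right\}$.
   Context: The domination number $\gamma(G)$ is the minimum cardinality of a set $D \subseteq V$ such that every vertex of $V\setminus D$ is adjacent to some vertex of $D$. The girth of a graph is the length of its shortest cycle (taken to be infinite if the graph has no cycle). -}

module Defs where

open import Data.Nat using (ℕ; zero; suc; _≤_; _<_)
open import Data.Fin using (Fin; zero; suc; inject₁; fromℕ; _<?_)
open import Data.Fin.Subset using (Subset; _∈_; ∣_∣)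
open import Data.List using (List; length; filter; allFin; cartesianProduct)
open import Data.Product using (Σ; ∃; _×_; _,_; proj₁; proj₂)
open import Data.Sum using (_⊎_)
open import Relation.Nullary using (Dec; ¬_)
open import Relation.Nullary.Decidable using (_×-dec_)
open import Relation.Binary.PropositionalEquality using (_≡_)
open import Relation.Binary.Construct.Closure.ReflexiveTransitive using (Star)
open import Function.Definitions using (Injective)

record Graph (n : ℕ) : Set₁ where
  field
    Adj   : Fin n → Fin n → Set
    adj?  : ∀ u v → Dec (Adj u v)
    sym   : ∀ {u v} → Adj u v → Adj v u
    irrefl : ∀ {u} → ¬ Adj u u

module _ {n : ℕ} (G : Graph n) where
  open Graph G

  edgeCount : ℕ
  edgeCount = length (filter (λ p → (proj₁ p <? proj₂ p) ×-dec adj? (proj₁ p) (proj₂ p))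
                             (cartesianProduct (allFin n) (allFin n)))

  degree : Fin n → ℕ
  degree u = length (filter (adj? u) (allFin n))

  MinDegree : ℕ → Set
  MinDegree d = (∀ v → d ≤ degree v) × (∃ λ v → degree v ≡ d)

  Connected : Set
  Connected = ∀ u v → Star Adj u v

  -- a cycle of length 3 + j: distinct vertices c 0, …, c (2+j),
  -- consecutive ones adjacent, and the last adjacent to the first
  record Cycle (j : ℕ) : Set where
    field
      c     : Fin (suc (suc (suc j))) → Fin n
      inj   : Injective _≡_ _≡_ c
      step  : ∀ (i : Fin (suc (suc j))) → Adj (c (inject₁ i)) (c (suc i))
      close : Adj (c (fromℕ (suc (suc j)))) (c zero)

  GirthAtLeast : ℕ → Set
  GirthAtLeast g = ∀ j → Cycle j → g ≤ suc (suc (suc j))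

  Dominating : Subset n → Set
  Dominating D = ∀ v → v ∈ D ⊎ (∃ λ u → u ∈ D × Adj v u)

  IsDominationNumber : ℕ → Set
  IsDominationNumber γ =
    (∃ λ D → Dominating D × ∣ D ∣ ≡ γ) × (∀ D → Dominating D → γ ≤ ∣ D ∣)

module Submission where

-- Let D be a minimum dominating set, γ = |D|.  Assign to every vertex v a
-- centre c(v) ∈ D: v itself if v ∈ D, otherwise a neighbour in D.  The
-- fibres of c are stars.  Inside a star any two vertices are joined by a
-- path of at most two edges, so two distinct edges between the same pair
-- of stars would close a cycle of length at most 6; with girth ≥ 7 every
-- pair of stars is joined by at most one edge.  An edge inside a star
-- joins the centre to a leaf (two leaves would form a triangle).  Hence
--     m ≤ (n − γ) + γ(γ−1)/2,
-- which rearranges to (2γ−3)² ≥ 8(m−n)+9.  If moreover every degree is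
-- ≥ 2, each leaf x has a neighbour outside its star, and the resulting
-- map x ↦ (edge, orientation) is injective, so n − γ ≤ γ(γ−1); together
-- with the edge bound this gives n ≤ γ² and 2m ≤ 3γ².

open import Defs
open import Data.Nat using (ℕ; suc; _≤_; _*_)
open import Data.Integer using (ℤ; +_; _-_; _+_) renaming (_*_ to _*ℤ_; _≤_ to _≤ℤ_)
open import Data.Product using (_×_)
open import Data.Sum using (_⊎_)
open import Relation.Binary.PropositionalEquality using (_≡_)

open import Data.Nat as ℕ using (z≤n; s≤s)
import Data.Nat.Properties as ℕP
open import Data.Nat.Tactic.RingSolver using (solve-∀)
import Data.Integer as ℤ
import Data.Integer.Properties as ℤP
import Data.Integer.Tactic.RingSolver as ℤSolver
open import Data.Fin as F using (Fin; inject₁; fromℕ) renaming (zero to fzero; suc to fsuc)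
import Data.Fin.Properties as FP
open import Data.Fin.Subset using (Subset; inside; outside; ∁; ∣_∣) renaming (_∈_ to _∈ₛ_; _∉_ to _∉ₛ_)
open import Data.Fin.Subset.Properties using (∣p∣≤n; ∣∁p∣≡n∸∣p∣; x∉p⇒x∈∁p; x∈∁p⇒x∉p) renaming (_∈?_ to _∈ₛ?_)
open import Data.Vec using ([]; _∷_; here; there)
open import Data.List using (List; []; _∷_; _++_; length; map; filter; allFin; cartesianProduct; lookup)
import Data.List.Properties as LP
import Data.List.Membership.DecPropositional as DecMembership
open import Data.List.Membership.Propositional using (_∈_)
open import Data.List.Membership.Propositional.Properties
  using (∈-lookup; ∈-map⁺; ∈-map⁻; ∈-++⁺ˡ; ∈-++⁺ʳ; ∈-filter⁻; ∈-length)
open import Data.List.Relation.Unary.Any using (here; there; index)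
open import Data.List.Relation.Unary.Any.Properties using (lookup-index)
open import Data.List.Relation.Unary.All as All using (All; []; _∷_)
open import Data.List.Relation.Unary.AllPairs using ([]; _∷_)
open import Data.List.Relation.Unary.Linked using (Linked; [-]; _∷_)
open import Data.List.Relation.Unary.Unique.Propositional using (Unique)
import Data.List.Relation.Unary.Unique.Propositional.Properties as Unique
open import Data.Product using (Σ; ∃; _,_; proj₁; proj₂)
open import Data.Product.Properties using (≡-dec)
open import Data.Sum using (inj₁; inj₂)
open import Data.Sum.Properties using (inj₁-injective; inj₂-injective)
open import Data.Bool using (Bool; true; false)
open import Data.Empty using (⊥; ⊥-elim)
open import Relation.Nullary using (Dec; yes; no; does)
open import Relation.Nullary.Decidable using (_×-dec_)
open import Relation.Binary.Definitions using (DecidableEquality)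
open import Relation.Binary.PropositionalEquality
  using (refl; sym; trans; cong; cong₂; subst; _≢_; module ≡-Reasoning)

-- Counting is done by injections between duplicate-free lists.
module _ {A : Set} where

  lookup-injective : {xs : List A} → Unique xs → ∀ i j → lookup xs i ≡ lookup xs j → i ≡ j
  lookup-injective (_ ∷ _) fzero fzero _ = refl
  lookup-injective (x∉xs ∷ _) fzero (fsuc j) e = ⊥-elim (All.lookup x∉xs (∈-lookup j) e)
  lookup-injective (x∉xs ∷ _) (fsuc i) fzero e = ⊥-elim (All.lookup x∉xs (∈-lookup i) (sym e))
  lookup-injective (_ ∷ u) (fsuc i) (fsuc j) e = cong fsuc (lookup-injective u i j e)

  length-≤-by-injection : {B : Set} (xs : List A) (ys : List B) (g : A → B) → Unique xs →
    (∀ {x} → x ∈ xs → g x ∈ ys) →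
    (∀ {x y} → x ∈ xs → y ∈ xs → g x ≡ g y → x ≡ y) →
    length xs ≤ length ys
  length-≤-by-injection xs ys g uniq into inj = FP.injective⇒≤ position-injective
    where
    position : Fin (length xs) → Fin (length ys)
    position i = index (into (∈-lookup i))

    position-injective : ∀ {i j} → position i ≡ position j → i ≡ j
    position-injective {i} {j} e = lookup-injective uniq i j (inj (∈-lookup i) (∈-lookup j) (begin
      g (lookup xs i)        ≡⟨ lookup-index (into (∈-lookup i)) ⟩
      lookup ys (position i) ≡⟨ cong (lookup ys) e ⟩
      lookup ys (position j) ≡⟨ sym (lookup-index (into (∈-lookup j))) ⟩
      g (lookup xs j)        ∎))
      where open ≡-Reasoning

  length-tagged : {B C : Set} (f : A → C) (g : B → C) (xs : List A) (ys : List B) →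
    length (map f xs ++ map g ys) ≡ length xs ℕ.+ length ys
  length-tagged f g xs ys =
    trans (LP.length-++ (map f xs)) (cong₂ ℕ._+_ (LP.length-map f xs) (LP.length-map g ys))

  pairs : List A → List (A × A)
  pairs [] = []
  pairs (x ∷ xs) = map (x ,_) xs ++ pairs xs

  length-pairs : ∀ xs → 2 * length (pairs xs) ℕ.+ length xs ≡ length xs * length xs
  length-pairs [] = refl
  length-pairs (x ∷ xs) = begin
    2 * length (map (x ,_) xs ++ pairs xs) ℕ.+ suc L ≡⟨ cong (λ k → 2 * k ℕ.+ suc L) length-split ⟩
    2 * (L ℕ.+ P) ℕ.+ suc L                         ≡⟨ regroup L P ⟩
    suc (2 * L) ℕ.+ (2 * P ℕ.+ L)                   ≡⟨ cong (suc (2 * L) ℕ.+_) (length-pairs xs) ⟩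
    suc (2 * L) ℕ.+ L * L                           ≡⟨ square L ⟩
    suc L * suc L                                   ∎
    where
    open ≡-Reasoning
    L = length xs
    P = length (pairs xs)
    regroup : ∀ L P → 2 * (L ℕ.+ P) ℕ.+ suc L ≡ suc (2 * L) ℕ.+ (2 * P ℕ.+ L)
    regroup = solve-∀
    square : ∀ L → suc (2 * L) ℕ.+ L * L ≡ suc L * suc L
    square = solve-∀
    length-split : length (map (x ,_) xs ++ pairs xs) ≡ L ℕ.+ P
    length-split = trans (LP.length-++ (map (x ,_) xs)) (cong (ℕ._+ P) (LP.length-map (x ,_) xs))

  pairs-cover : ∀ xs {a b} → a ∈ xs → b ∈ xs → a ≢ b → (a , b) ∈ pairs xs ⊎ (b , a) ∈ pairs xs
  pairs-cover (x ∷ xs) (here refl) (here refl) a≢b = ⊥-elim (a≢b refl)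
  pairs-cover (x ∷ xs) (here refl) (there b∈) _ = inj₁ (∈-++⁺ˡ (∈-map⁺ (x ,_) b∈))
  pairs-cover (x ∷ xs) (there a∈) (here refl) _ = inj₂ (∈-++⁺ˡ (∈-map⁺ (x ,_) a∈))
  pairs-cover (x ∷ xs) (there a∈) (there b∈) a≢b with pairs-cover xs a∈ b∈ a≢b
  ... | inj₁ p = inj₁ (∈-++⁺ʳ (map (x ,_) xs) p)
  ... | inj₂ p = inj₂ (∈-++⁺ʳ (map (x ,_) xs) p)

  avoid : DecidableEquality A → {xs : List A} → Unique xs → 2 ≤ length xs → ∀ c → ∃ λ y → y ∈ xs × y ≢ c
  avoid _≟_ {_ ∷ []} _ (s≤s ()) _
  avoid _≟_ {y₁ ∷ y₂ ∷ _} ((y₁≢y₂ ∷ _) ∷ _) _ c with y₁ ≟ c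
  ... | yes y₁≡c = y₂ , there (here refl) , (λ y₂≡c → y₁≢y₂ (trans y₁≡c (sym y₂≡c)))
  ... | no y₁≢c = y₁ , here refl , y₁≢c

<?-antisym : ∀ {n} {a b : Fin n} → a ≢ b → does (a F.<? b) ≢ does (b F.<? a)
<?-antisym {a = a} {b} a≢b = compare (a F.<? b) (b F.<? a)
  where
  compare : (a<?b : Dec (a F.< b)) (b<?a : Dec (b F.< a)) → does a<?b ≢ does b<?a
  compare (yes a<b) (yes b<a) _ = FP.<-asym a<b b<a
  compare (no a≮b) (no b≮a) _ = a≢b (FP.≤-antisym (ℕP.≮⇒≥ b≮a) (ℕP.≮⇒≥ a≮b))

-- Given a list ps of pairs, orient a b is whichever of (a , b) and (b , a)
-- lies in ps (if either does); it represents the unordered pair {a , b}.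
module Orientation {A : Set} (_≟_ : DecidableEquality A) (ps : List (A × A)) where
  open DecMembership (≡-dec _≟_ _≟_) using (_∈?_)

  orient : A → A → A × A
  orient a b with (a , b) ∈? ps
  ... | yes _ = a , b
  ... | no _ = b , a

  orient-∈ : ∀ {a b} → (a , b) ∈ ps ⊎ (b , a) ∈ ps → orient a b ∈ ps
  orient-∈ {a} {b} either with (a , b) ∈? ps | either
  ... | yes ab∈ | _ = ab∈
  ... | no ab∉ | inj₁ ab∈ = ⊥-elim (ab∉ ab∈)
  ... | no _ | inj₂ ba∈ = ba∈

  orient-injective : ∀ {a b c d} → orient a b ≡ orient c d → (a ≡ c × b ≡ d) ⊎ (a ≡ d × b ≡ c)
  orient-injective {a} {b} {c} {d} e with (a , b) ∈? ps | (c , d) ∈? ps | e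
  ... | yes _ | yes _ | refl = inj₁ (refl , refl)
  ... | yes _ | no _ | refl = inj₂ (refl , refl)
  ... | no _ | yes _ | refl = inj₂ (refl , refl)
  ... | no _ | no _ | refl = inj₁ (refl , refl)

elements : ∀ {n} → Subset n → List (Fin n)
elements [] = []
elements (inside ∷ p) = fzero ∷ map fsuc (elements p)
elements (outside ∷ p) = map fsuc (elements p)

length-elements : ∀ {n} (p : Subset n) → length (elements p) ≡ ∣ p ∣
length-elements [] = refl
length-elements (inside ∷ p) = cong suc (trans (LP.length-map fsuc (elements p)) (length-elements p))
length-elements (outside ∷ p) = trans (LP.length-map fsuc (elements p)) (length-elements p)

elements-unique : ∀ {n} (p : Subset n) → Unique (elements p)
elements-unique [] = []
elements-unique (inside ∷ p) = zero∉ (elements p) ∷ Unique.map⁺ FP.suc-injective (elements-unique p)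
  where
  zero∉ : ∀ {n} (xs : List (Fin n)) → All (fzero ≢_) (map fsuc xs)
  zero∉ [] = []
  zero∉ (_ ∷ xs) = (λ ()) ∷ zero∉ xs
elements-unique (outside ∷ p) = Unique.map⁺ FP.suc-injective (elements-unique p)

∈-elements⁺ : ∀ {n} (p : Subset n) {x} → x ∈ₛ p → x ∈ elements p
∈-elements⁺ (inside ∷ p) here = here refl
∈-elements⁺ (inside ∷ p) (there x∈p) = there (∈-map⁺ fsuc (∈-elements⁺ p x∈p))
∈-elements⁺ (outside ∷ p) (there x∈p) = ∈-map⁺ fsuc (∈-elements⁺ p x∈p)

∈-elements⁻ : ∀ {n} (p : Subset n) {x} → x ∈ elements p → x ∈ₛ p
∈-elements⁻ (inside ∷ p) (here refl) = here
∈-elements⁻ (inside ∷ p) (there x∈) with ∈-map⁻ fsuc x∈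
... | _ , y∈ , refl = there (∈-elements⁻ p y∈)
∈-elements⁻ (outside ∷ p) x∈ with ∈-map⁻ fsuc x∈
... | _ , y∈ , refl = there (∈-elements⁻ p y∈)

module Paths {n : ℕ} (G : Graph n) where
  open Graph G renaming (sym to adj-sym)

  Path : List (Fin n) → Set
  Path = Linked Adj

  endpoint : Fin n → List (Fin n) → Fin n
  endpoint x [] = x
  endpoint x (y ∷ ys) = endpoint y ys

  endpoint-++ : ∀ x ys z zs → endpoint x (ys ++ z ∷ zs) ≡ endpoint z zs
  endpoint-++ x [] z zs = refl
  endpoint-++ x (y ∷ ys) z zs = endpoint-++ y ys z zs

  path-++ : ∀ {x z} ys zs → Path (x ∷ ys) → Adj (endpoint x ys) z → Path (z ∷ zs) → Path (x ∷ ys ++ z ∷ zs)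
  path-++ [] zs [-] a q = a ∷ q
  path-++ (y ∷ ys) zs (a ∷ p) b q = a ∷ path-++ ys zs p b q

  -- Read as a function on positions, a path is a sequence of consecutively adjacent
  -- vertices ending in its endpoint; this is the form Cycle asks for.
  endpoint-lookup : ∀ x ys → lookup (x ∷ ys) (fromℕ (length ys)) ≡ endpoint x ys
  endpoint-lookup x [] = refl
  endpoint-lookup x (y ∷ ys) = endpoint-lookup y ys

  path-step : ∀ {x ys} → Path (x ∷ ys) → ∀ (i : Fin (length ys)) →
              Adj (lookup (x ∷ ys) (inject₁ i)) (lookup (x ∷ ys) (fsuc i))
  path-step (a ∷ p) fzero = a
  path-step (a ∷ p) (fsuc i) = path-step p i

  girth≤cycle : ∀ {g} → GirthAtLeast G g → ∀ x ys → 2 ≤ length ys →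
    Unique (x ∷ ys) → Path (x ∷ ys) → Adj (endpoint x ys) x → g ≤ suc (length ys)
  girth≤cycle girth x (y ∷ []) (s≤s ()) _ _ _
  girth≤cycle girth x (y ∷ z ∷ rest) _ simple path closing = girth (length rest) (record
    { c = lookup (x ∷ y ∷ z ∷ rest)
    ; inj = λ {i} {j} → lookup-injective simple i j
    ; step = path-step path
    ; close = subst (λ w → Adj w x) (sym (endpoint-lookup x (y ∷ z ∷ rest))) closing
    })

  adj⇒≢ : ∀ {u v} → Adj u v → u ≢ v
  adj⇒≢ a refl = irrefl a

  triangle-free : ∀ {g} → GirthAtLeast G g → 4 ≤ g → ∀ {x y z} → Adj x y → Adj y z → Adj z x → ⊥
  triangle-free girth 4≤g {x} {y} {z} xy yz zx =
    ℕP.<⇒≱ 4≤g (girth≤cycle girth x (y ∷ z ∷ []) (s≤s (s≤s z≤n)) simple (xy ∷ yz ∷ [-]) zx)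
    where
    simple : Unique (x ∷ y ∷ z ∷ [])
    simple = (adj⇒≢ xy ∷ (λ x≡z → adj⇒≢ zx (sym x≡z)) ∷ []) ∷ (adj⇒≢ yz ∷ []) ∷ [] ∷ []

module Stars {n : ℕ} (G : Graph n) (girth : GirthAtLeast G 7) (D : Subset n) (dom : Dominating G D) where
  open Graph G renaming (sym to adj-sym)
  open Paths G

  centreOf : ∀ v → Σ (Fin n) λ c → c ∈ₛ D × (v ∈ₛ D → c ≡ v) × (v ∉ₛ D → Adj v c)
  centreOf v with v ∈ₛ? D
  ... | yes v∈D = v , v∈D , (λ _ → refl) , (λ v∉D → ⊥-elim (v∉D v∈D))
  ... | no v∉D with dom v
  ...   | inj₁ v∈D = ⊥-elim (v∉D v∈D)
  ...   | inj₂ (u , u∈D , vu) = u , u∈D , (λ v∈D → ⊥-elim (v∉D v∈D)) , (λ _ → vu)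

  centre : Fin n → Fin n
  centre v = proj₁ (centreOf v)

  centre∈D : ∀ v → centre v ∈ₛ D
  centre∈D v = proj₁ (proj₂ (centreOf v))

  centre-fixes-D : ∀ {v} → v ∈ₛ D → centre v ≡ v
  centre-fixes-D {v} = proj₁ (proj₂ (proj₂ (centreOf v)))

  leaf-adj-centre : ∀ {v} → v ∉ₛ D → Adj v (centre v)
  leaf-adj-centre {v} = proj₂ (proj₂ (proj₂ (centreOf v)))

  -- The star of a is the set of vertices with centre a; a is its own centre.
  centre-idem : ∀ {v a} → centre v ≡ a → centre a ≡ a
  centre-idem {v} refl = centre-fixes-D (centre∈D v)

  toCentre : ∀ {v a} → centre v ≡ a → v ≢ a → Adj v a
  toCentre {v} refl v≢a = by-membership (v ∈ₛ? D)
    where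
    by-membership : Dec (v ∈ₛ D) → Adj v (centre v)
    by-membership (yes v∈D) = ⊥-elim (v≢a (sym (centre-fixes-D v∈D)))
    by-membership (no v∉D) = leaf-adj-centre v∉D

  no-triangle : ∀ {x y z} → Adj x y → Adj y z → Adj z x → ⊥
  no-triangle = triangle-free girth (s≤s (s≤s (s≤s (s≤s z≤n))))

  -- A simple path u = w₀, w₁, …, wₖ = v with k ≤ 2 inside the star of a;
  -- rest lists w₁, …, wₖ.
  record StarPath (a u v : Fin n) : Set where
    field
      rest       : List (Fin n)
      simple     : Unique (u ∷ rest)
      path       : Path (u ∷ rest)
      ends       : endpoint u rest ≡ v
      inStar     : All (λ w → centre w ≡ a) (u ∷ rest)
      short      : length rest ≤ 2
      nontrivial : u ≢ v → 1 ≤ length rest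

  -- Any two vertices of a star are joined through its centre.
  starPath : ∀ {a u v} → centre u ≡ a → centre v ≡ a → StarPath a u v
  starPath {a} {u} {v} cu cv with u F.≟ v | u F.≟ a | v F.≟ a
  ... | yes refl | _ | _ = record
    { rest = [] ; simple = [] ∷ [] ; path = [-] ; ends = refl
    ; inStar = cu ∷ [] ; short = z≤n ; nontrivial = λ u≢u → ⊥-elim (u≢u refl) }
  ... | no u≢v | yes refl | _ = record
    { rest = v ∷ [] ; simple = (u≢v ∷ []) ∷ [] ∷ []
    ; path = adj-sym (toCentre cv (λ v≡u → u≢v (sym v≡u))) ∷ [-] ; ends = refl
    ; inStar = cu ∷ cv ∷ [] ; short = s≤s z≤n ; nontrivial = λ _ → s≤s z≤n }
  ... | no u≢v | no u≢a | yes refl = record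
    { rest = a ∷ [] ; simple = (u≢a ∷ []) ∷ [] ∷ []
    ; path = toCentre cu u≢a ∷ [-] ; ends = refl
    ; inStar = cu ∷ centre-idem {u} cu ∷ [] ; short = s≤s z≤n ; nontrivial = λ _ → s≤s z≤n }
  ... | no u≢v | no u≢a | no v≢a = record
    { rest = a ∷ v ∷ [] ; simple = (u≢a ∷ u≢v ∷ []) ∷ ((λ a≡v → v≢a (sym a≡v)) ∷ []) ∷ [] ∷ []
    ; path = toCentre cu u≢a ∷ adj-sym (toCentre cv v≢a) ∷ [-] ; ends = refl
    ; inStar = cu ∷ centre-idem {u} cu ∷ cv ∷ [] ; short = s≤s (s≤s z≤n) ; nontrivial = λ _ → s≤s z≤n }

  -- Two different edges x₁y₁, x₂y₂ from the star of a to the star of b ≠ a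
  -- close the cycle x₂ ⇝ x₁ – y₁ ⇝ y₂ – x₂ of length at most 6.
  two-edges-between-stars : ∀ {x₁ y₁ x₂ y₂} → Adj x₁ y₁ → Adj x₂ y₂ →
    centre x₁ ≡ centre x₂ → centre y₁ ≡ centre y₂ → centre x₁ ≢ centre y₁ →
    x₁ ≢ x₂ ⊎ y₁ ≢ y₂ → ⊥
  two-edges-between-stars {x₁} {y₁} {x₂} {y₂} x₁y₁ x₂y₂ cx cy a≢b different =
    ℕP.<⇒≱ (s≤s (s≤s cycle≤5)) (girth≤cycle girth x₂ (RX ++ y₁ ∷ RY) cycle≥2 simple path closing)
    where
    X = starPath {centre x₁} {x₂} {x₁} (sym cx) refl
    Y = starPath {centre y₁} {y₁} {y₂} refl (sym cy)
    module X = StarPath X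
    module Y = StarPath Y
    RX = X.rest
    RY = Y.rest

    length-cycle : length (RX ++ y₁ ∷ RY) ≡ length RX ℕ.+ suc (length RY)
    length-cycle = LP.length-++ RX

    cycle≤5 : length (RX ++ y₁ ∷ RY) ≤ 5
    cycle≤5 = subst (_≤ 5) (sym length-cycle) (ℕP.+-mono-≤ X.short (s≤s Y.short))

    cycle≥2 : 2 ≤ length (RX ++ y₁ ∷ RY)
    cycle≥2 = subst (2 ≤_) (sym length-cycle) (long different)
      where
      long : x₁ ≢ x₂ ⊎ y₁ ≢ y₂ → 2 ≤ length RX ℕ.+ suc (length RY)
      long (inj₁ x₁≢x₂) = ℕP.+-mono-≤ (X.nontrivial (λ x₂≡x₁ → x₁≢x₂ (sym x₂≡x₁))) (s≤s z≤n)
      long (inj₂ y₁≢y₂) = ℕP.≤-trans (s≤s (Y.nontrivial y₁≢y₂)) (ℕP.m≤n+m _ (length RX))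

    -- the two halves lie in the disjoint stars of a and b
    simple : Unique (x₂ ∷ RX ++ y₁ ∷ RY)
    simple = Unique.++⁺ X.simple Y.simple
      (λ (w∈X , w∈Y) → a≢b (trans (sym (All.lookup X.inStar w∈X)) (All.lookup Y.inStar w∈Y)))

    path : Path (x₂ ∷ RX ++ y₁ ∷ RY)
    path = path-++ RX RY X.path (subst (λ w → Adj w y₁) (sym X.ends) x₁y₁) Y.path

    closing : Adj (endpoint x₂ (RX ++ y₁ ∷ RY)) x₂
    closing = subst (λ w → Adj w x₂) (sym (trans (endpoint-++ x₂ RX y₁ RY) Y.ends)) (adj-sym x₂y₂)

  unique-edge-between-stars : ∀ {x₁ y₁ x₂ y₂} → Adj x₁ y₁ → Adj x₂ y₂ →
    centre x₁ ≡ centre x₂ → centre y₁ ≡ centre y₂ → centre x₁ ≢ centre y₁ → x₁ ≡ x₂ × y₁ ≡ y₂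
  unique-edge-between-stars {x₁} {y₁} {x₂} {y₂} e₁ e₂ cx cy a≢b with x₁ F.≟ x₂ | y₁ F.≟ y₂
  ... | yes x₁≡x₂ | yes y₁≡y₂ = x₁≡x₂ , y₁≡y₂
  ... | no x₁≢x₂ | _ = ⊥-elim (two-edges-between-stars e₁ e₂ cx cy a≢b (inj₁ x₁≢x₂))
  ... | yes _ | no y₁≢y₂ = ⊥-elim (two-edges-between-stars e₁ e₂ cx cy a≢b (inj₂ y₁≢y₂))

  JoinsToCentre : Fin n → Fin n → Fin n → Set
  JoinsToCentre u v w = (u ≡ centre w × v ≡ w) ⊎ (u ≡ w × v ≡ centre w)

  -- the endpoint of uv that is not the centre (when uv lies inside a star)
  leaf : Fin n → Fin n → Fin n
  leaf u v with u F.≟ centre u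
  ... | yes _ = v
  ... | no _ = u

  -- An edge inside a star joins a leaf outside D to the centre:
  -- two leaves of one star are never adjacent, since that would close a triangle.
  edge-inside-star : ∀ {u v} → Adj u v → centre u ≡ centre v → leaf u v ∉ₛ D × JoinsToCentre u v (leaf u v)
  edge-inside-star {u} {v} uv cu≡cv with u F.≟ centre u
  ... | yes u≡cu = v∉D , inj₁ (trans u≡cu cu≡cv , refl)
    where
    v∉D : v ∉ₛ D
    v∉D v∈D = adj⇒≢ uv (trans u≡cu (trans cu≡cv (centre-fixes-D v∈D)))
  ... | no u≢cu = (λ u∈D → u≢cu (sym (centre-fixes-D u∈D))) , inj₂ (refl , v≡cu)
    where
    v≡cu : v ≡ centre u
    v≡cu with v F.≟ centre v
    ... | yes v≡cv = trans v≡cv (sym cu≡cv)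
    ... | no v≢cv = ⊥-elim (no-triangle uv (toCentre (sym cu≡cv) (λ v≡cu → v≢cv (trans v≡cu cu≡cv)))
                                                 (adj-sym (toCentre refl u≢cu)))

  same-leaf⇒same-edge : ∀ {u₁ v₁ u₂ v₂ w} → u₁ F.< v₁ → u₂ F.< v₂ →
    JoinsToCentre u₁ v₁ w → JoinsToCentre u₂ v₂ w → (u₁ , v₁) ≡ (u₂ , v₂)
  same-leaf⇒same-edge _ _ (inj₁ (refl , refl)) (inj₁ (refl , refl)) = refl
  same-leaf⇒same-edge l₁ l₂ (inj₁ (refl , refl)) (inj₂ (refl , refl)) = ⊥-elim (FP.<-asym l₁ l₂)
  same-leaf⇒same-edge l₁ l₂ (inj₂ (refl , refl)) (inj₁ (refl , refl)) = ⊥-elim (FP.<-asym l₁ l₂)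
  same-leaf⇒same-edge _ _ (inj₂ (refl , refl)) (inj₂ (refl , refl)) = refl

  members outsiders : List (Fin n)
  members = elements D
  outsiders = elements (∁ D)

  centrePairs : List (Fin n × Fin n)
  centrePairs = pairs members

  open Orientation F._≟_ centrePairs

  centrePair : Fin n → Fin n → Fin n × Fin n
  centrePair u v = orient (centre u) (centre v)

  centrePair-∈ : ∀ {u v} → centre u ≢ centre v → centrePair u v ∈ centrePairs
  centrePair-∈ {u} {v} cu≢cv =
    orient-∈ (pairs-cover members (∈-elements⁺ D (centre∈D u)) (∈-elements⁺ D (centre∈D v)) cu≢cv)

  edge-between-stars-injective : ∀ {x₁ y₁ x₂ y₂} → Adj x₁ y₁ → Adj x₂ y₂ → centre x₁ ≢ centre y₁ →
    centrePair x₁ y₁ ≡ centrePair x₂ y₂ → (x₁ ≡ x₂ × y₁ ≡ y₂) ⊎ (x₁ ≡ y₂ × y₁ ≡ x₂)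
  edge-between-stars-injective e₁ e₂ a≢b same with orient-injective same
  ... | inj₁ (cx , cy) = inj₁ (unique-edge-between-stars e₁ e₂ cx cy a≢b)
  ... | inj₂ (cx , cy) = inj₂ (unique-edge-between-stars e₁ (adj-sym e₂) cx cy a≢b)

  isEdge? : (p : Fin n × Fin n) → Dec (proj₁ p F.< proj₂ p × Adj (proj₁ p) (proj₂ p))
  isEdge? (u , v) = (u F.<? v) ×-dec adj? u v

  edges : List (Fin n × Fin n)
  edges = filter isEdge? (cartesianProduct (allFin n) (allFin n))

  edges-unique : Unique edges
  edges-unique = Unique.filter⁺ isEdge? (Unique.cartesianProduct⁺ (Unique.allFin⁺ n) (Unique.allFin⁺ n))

  ∈-edges⁻ : ∀ {u v} → (u , v) ∈ edges → u F.< v × Adj u v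
  ∈-edges⁻ e∈ = proj₂ (∈-filter⁻ isEdge? {xs = cartesianProduct (allFin n) (allFin n)} e∈)

  charge : Fin n × Fin n → Fin n ⊎ (Fin n × Fin n)
  charge (u , v) with centre u F.≟ centre v
  ... | yes _ = inj₁ (leaf u v)
  ... | no _ = inj₂ (centrePair u v)

  charge-∈ : ∀ {e} → e ∈ edges → charge e ∈ map inj₁ outsiders ++ map inj₂ centrePairs
  charge-∈ {u , v} e∈ with centre u F.≟ centre v
  ... | yes cu≡cv = ∈-++⁺ˡ (∈-map⁺ inj₁ (∈-elements⁺ (∁ D) (x∉p⇒x∈∁p leaf∉D)))
    where leaf∉D = proj₁ (edge-inside-star (proj₂ (∈-edges⁻ e∈)) cu≡cv)
  ... | no cu≢cv = ∈-++⁺ʳ (map inj₁ outsiders) (∈-map⁺ inj₂ (centrePair-∈ {u} {v} cu≢cv))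

  charge-injective : ∀ {e₁ e₂} → e₁ ∈ edges → e₂ ∈ edges → charge e₁ ≡ charge e₂ → e₁ ≡ e₂
  charge-injective {u₁ , v₁} {u₂ , v₂} e₁∈ e₂∈ same
    with ∈-edges⁻ e₁∈ | ∈-edges⁻ e₂∈ | centre u₁ F.≟ centre v₁ | centre u₂ F.≟ centre v₂ | same
  ... | u₁<v₁ , u₁v₁ | u₂<v₂ , u₂v₂ | yes c₁ | yes c₂ | same-leaf =
    same-leaf⇒same-edge u₁<v₁ u₂<v₂ (proj₂ (edge-inside-star u₁v₁ c₁))
      (subst (JoinsToCentre u₂ v₂) (sym (inj₁-injective same-leaf)) (proj₂ (edge-inside-star u₂v₂ c₂)))
  ... | u₁<v₁ , u₁v₁ | u₂<v₂ , u₂v₂ | no c₁ | no _ | same-centres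
    with edge-between-stars-injective u₁v₁ u₂v₂ c₁ (inj₂-injective same-centres)
  ...   | inj₁ (refl , refl) = refl
  ...   | inj₂ (refl , refl) = ⊥-elim (FP.<-asym u₁<v₁ u₂<v₂)

  edge-bound : edgeCount G ≤ length outsiders ℕ.+ length centrePairs
  edge-bound = subst (edgeCount G ≤_) (length-tagged inj₁ inj₂ outsiders centrePairs)
    (length-≤-by-injection edges _ charge edges-unique charge-∈ charge-injective)

  -- If every degree is at least 2, each leaf x has a neighbour in another star, and
  -- x ↦ (pair of stars of that edge, orientation) is injective: n − γ ≤ γ(γ−1).
  module MinimumDegreeTwo (deg≥2 : ∀ v → 2 ≤ degree G v) where

    otherNeighbour : ∀ x → Σ (Fin n) λ y → Adj x y × y ≢ centre x
    otherNeighbour x with avoid F._≟_ (Unique.filter⁺ (adj? x) (Unique.allFin⁺ n)) (deg≥2 x) (centre x)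
    ... | y , y∈ , y≢cx = y , proj₂ (∈-filter⁻ (adj? x) {xs = allFin n} y∈) , y≢cx

    partner : Fin n → Fin n
    partner x = proj₁ (otherNeighbour x)

    partner-adj : ∀ x → Adj x (partner x)
    partner-adj x = proj₁ (proj₂ (otherNeighbour x))

    -- a neighbour of a leaf in its own star would form a triangle with the centre
    leaf-edge-crosses : ∀ {x} → x ∉ₛ D → centre x ≢ centre (partner x)
    leaf-edge-crosses {x} x∉D same = no-triangle (partner-adj x)
      (toCentre (sym same) (proj₂ (proj₂ (otherNeighbour x)))) (adj-sym (leaf-adj-centre x∉D))

    signature : Fin n → (Fin n × Fin n) × Bool
    signature x = centrePair x (partner x) , does (x F.<? partner x)

    signature-∈ : ∀ {x} → x ∈ outsiders → signature x ∈ map (_, true) centrePairs ++ map (_, false) centrePairs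
    signature-∈ {x} x∈ = tagged (centrePair-∈ {x} {partner x} (leaf-edge-crosses x∉D)) _
      where
      tagged : ∀ {p} → p ∈ centrePairs → ∀ b → (p , b) ∈ map (_, true) centrePairs ++ map (_, false) centrePairs
      tagged p∈ true = ∈-++⁺ˡ (∈-map⁺ (_, true) p∈)
      tagged p∈ false = ∈-++⁺ʳ (map (_, true) centrePairs) (∈-map⁺ (_, false) p∈)
      x∉D : x ∉ₛ D
      x∉D = x∈∁p⇒x∉p (∈-elements⁻ (∁ D) x∈)

    -- Two leaves with the same signature share their edge with the same orientation.
    signature-injective : ∀ {x₁ x₂} → x₁ ∈ outsiders → x₂ ∈ outsiders → signature x₁ ≡ signature x₂ → x₁ ≡ x₂
    signature-injective {x₁} {x₂} x₁∈ _ same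
      with edge-between-stars-injective (partner-adj x₁) (partner-adj x₂)
             (leaf-edge-crosses (x∈∁p⇒x∉p (∈-elements⁻ (∁ D) x₁∈))) (cong proj₁ same)
    ... | inj₁ (x₁≡x₂ , _) = x₁≡x₂
    ... | inj₂ (x₁≡y₂ , y₁≡x₂) = ⊥-elim (<?-antisym (adj⇒≢ (partner-adj x₁))
            (trans (cong proj₂ same) (cong₂ (λ p q → does (p F.<? q)) (sym y₁≡x₂) (sym x₁≡y₂))))

    outsider-bound : length outsiders ≤ 2 * length centrePairs
    outsider-bound = subst (length outsiders ≤_)
      (trans (length-tagged (_, true) (_, false) centrePairs centrePairs)
             (cong (length centrePairs ℕ.+_) (sym (ℕP.+-identityʳ (length centrePairs)))))
      (length-≤-by-injection outsiders _ signature (elements-unique (∁ D)) signature-∈ signature-injective)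

-- With k = n − γ outsiders and P = γ(γ−1)/2 pairs, m ≤ k + P gives 8m + 12γ ≤ 8n + 4γ².
edge-inequality : ∀ m n k P γ → m ≤ k ℕ.+ P → k ℕ.+ γ ≡ n → 2 * P ℕ.+ γ ≡ γ * γ →
  8 * m ℕ.+ 12 * γ ≤ 8 * n ℕ.+ 4 * (γ * γ)
edge-inequality m n k P γ m≤k+P k+γ≡n 2P+γ≡γ² = begin
  8 * m ℕ.+ 12 * γ                  ≤⟨ ℕP.+-monoˡ-≤ (12 * γ) (ℕP.*-monoʳ-≤ 8 m≤k+P) ⟩
  8 * (k ℕ.+ P) ℕ.+ 12 * γ          ≡⟨ regroup k P γ ⟩
  8 * (k ℕ.+ γ) ℕ.+ 4 * (2 * P ℕ.+ γ) ≡⟨ cong₂ (λ a b → 8 * a ℕ.+ 4 * b) k+γ≡n 2P+γ≡γ² ⟩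
  8 * n ℕ.+ 4 * (γ * γ)             ∎
  where
  open ℕP.≤-Reasoning
  regroup : ∀ k P γ → 8 * (k ℕ.+ P) ℕ.+ 12 * γ ≡ 8 * (k ℕ.+ γ) ℕ.+ 4 * (2 * P ℕ.+ γ)
  regroup = solve-∀

completed-square : ∀ m n γ → 8 * m ℕ.+ 12 * γ ≤ 8 * n ℕ.+ 4 * (γ * γ) →
  (+ 8) *ℤ (+ m - + n) + + 9 ≤ℤ (+ (2 * γ) - + 3) *ℤ (+ (2 * γ) - + 3)
completed-square m n γ h = begin
  (+ 8) *ℤ (+ m - + n) + + 9                    ≡⟨ shift (+ m) (+ n) (+ γ) ⟩
  ((+ 8) *ℤ + m + (+ 12) *ℤ + γ) - c + + 9       ≡⟨ cong (λ z → z - c + + 9) (sym lhs-cast) ⟩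
  + (8 * m ℕ.+ 12 * γ) - c + + 9                ≤⟨ ℤP.+-monoˡ-≤ (+ 9) (ℤP.+-monoˡ-≤ (ℤ.- c) (ℤ.+≤+ h)) ⟩
  + (8 * n ℕ.+ 4 * (γ * γ)) - c + + 9           ≡⟨ cong (λ z → z - c + + 9) rhs-cast ⟩
  ((+ 8) *ℤ + n + (+ 4) *ℤ (+ γ *ℤ + γ)) - c + + 9 ≡⟨ square (+ n) (+ γ) ⟩
  ((+ 2) *ℤ + γ - + 3) *ℤ ((+ 2) *ℤ + γ - + 3)  ≡⟨ cong (λ z → (z - + 3) *ℤ (z - + 3)) (sym (ℤP.pos-* 2 γ)) ⟩
  (+ (2 * γ) - + 3) *ℤ (+ (2 * γ) - + 3)        ∎
  where
  open ℤP.≤-Reasoning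
  c = (+ 8) *ℤ + n + (+ 12) *ℤ + γ
  shift : ∀ M N Γ → (+ 8) *ℤ (M - N) + + 9 ≡ ((+ 8) *ℤ M + (+ 12) *ℤ Γ) - ((+ 8) *ℤ N + (+ 12) *ℤ Γ) + + 9
  shift = ℤSolver.solve-∀
  square : ∀ N Γ → ((+ 8) *ℤ N + (+ 4) *ℤ (Γ *ℤ Γ)) - ((+ 8) *ℤ N + (+ 12) *ℤ Γ) + + 9 ≡ ((+ 2) *ℤ Γ - + 3) *ℤ ((+ 2) *ℤ Γ - + 3)
  square = ℤSolver.solve-∀
  lhs-cast : + (8 * m ℕ.+ 12 * γ) ≡ (+ 8) *ℤ + m + (+ 12) *ℤ + γ
  lhs-cast = trans (ℤP.pos-+ (8 * m) (12 * γ)) (cong₂ _+_ (ℤP.pos-* 8 m) (ℤP.pos-* 12 γ))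
  rhs-cast : + (8 * n ℕ.+ 4 * (γ * γ)) ≡ (+ 8) *ℤ + n + (+ 4) *ℤ (+ γ *ℤ + γ)
  rhs-cast = trans (ℤP.pos-+ (8 * n) (4 * (γ * γ)))
    (cong₂ _+_ (ℤP.pos-* 8 n) (trans (ℤP.pos-* 4 (γ * γ)) (cong ((+ 4) *ℤ_) (ℤP.pos-* γ γ))))

vertex-inequality : ∀ n k P γ → k ≤ 2 * P → k ℕ.+ γ ≡ n → 2 * P ℕ.+ γ ≡ γ * γ → n ≤ γ * γ
vertex-inequality n k P γ k≤2P refl 2P+γ≡γ² = subst (k ℕ.+ γ ≤_) 2P+γ≡γ² (ℕP.+-monoˡ-≤ γ k≤2P)

edge-inequality-mindeg : ∀ m k P γ → k ≤ 2 * P → m ≤ k ℕ.+ P → 2 * P ℕ.+ γ ≡ γ * γ → 2 * m ≤ 3 * (γ * γ)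
edge-inequality-mindeg m k P γ k≤2P m≤k+P 2P+γ≡γ² = begin
  2 * m                  ≤⟨ ℕP.*-monoʳ-≤ 2 m≤k+P ⟩
  2 * (k ℕ.+ P)          ≤⟨ ℕP.*-monoʳ-≤ 2 (ℕP.+-monoˡ-≤ P k≤2P) ⟩
  2 * (2 * P ℕ.+ P)      ≤⟨ ℕP.≤-reflexive (sixfold P) ⟩
  6 * P                  ≤⟨ ℕP.m≤m+n (6 * P) (3 * γ) ⟩
  6 * P ℕ.+ 3 * γ        ≡⟨ distribute P γ ⟩
  3 * (2 * P ℕ.+ γ)      ≡⟨ cong (3 *_) 2P+γ≡γ² ⟩
  3 * (γ * γ)            ∎
  where
  open ℕP.≤-Reasoning
  sixfold : ∀ P → 2 * (2 * P ℕ.+ P) ≡ 6 * P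
  sixfold = solve-∀
  distribute : ∀ P γ → 6 * P ℕ.+ 3 * γ ≡ 3 * (2 * P ℕ.+ γ)
  distribute = solve-∀

dominating-nonempty : ∀ {n} (G : Graph n) {D : Subset n} → Fin n → Dominating G D → ∃ λ x → x ∈ₛ D
dominating-nonempty G v dom with dom v
... | inj₁ v∈D = v , v∈D
... | inj₂ (u , u∈D , _) = u , u∈D

-- The bounds hold for every dominating set.
theorem2 : (n : ℕ) → 1 ≤ n → (G : Graph n) → Connected G → GirthAtLeast G 7 →
    (γ : ℕ) → IsDominationNumber G γ →
    (γ ≡ 1 ⊎ (2 ≤ γ × ((+ 8) *ℤ (+ edgeCount G - + n) + + 9 ≤ℤ (+ (2 * γ) - + 3) *ℤ (+ (2 * γ) - + 3))))
    × (MinDegree G 2 → n ≤ γ * γ × 2 * edgeCount G ≤ 3 * (γ * γ))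
theorem2 n 1≤n G _ girth γ ((D , dom , ∣D∣≡γ) , _) = general-bound , min-degree-bound
  where
  open Stars G girth D dom
  k = length outsiders
  P = length centrePairs

  members≡γ : length members ≡ γ
  members≡γ = trans (length-elements D) ∣D∣≡γ

  k+γ≡n : k ℕ.+ γ ≡ n
  k+γ≡n = trans (cong₂ ℕ._+_ (trans (length-elements (∁ D)) (∣∁p∣≡n∸∣p∣ D)) (sym ∣D∣≡γ))
                (ℕP.m∸n+n≡m (∣p∣≤n D))

  2P+γ≡γ² : 2 * P ℕ.+ γ ≡ γ * γ
  2P+γ≡γ² = subst (λ L → 2 * P ℕ.+ L ≡ L * L) members≡γ (length-pairs members)

  γ≥1 : 1 ≤ γ
  γ≥1 = subst (1 ≤_) members≡γ (∈-length (∈-elements⁺ D (proj₂ (dominating-nonempty G (F.fromℕ< 1≤n) dom))))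

  general-bound : γ ≡ 1 ⊎ (2 ≤ γ × ((+ 8) *ℤ (+ edgeCount G - + n) + + 9 ≤ℤ (+ (2 * γ) - + 3) *ℤ (+ (2 * γ) - + 3)))
  general-bound with γ ℕ.≟ 1
  ... | yes γ≡1 = inj₁ γ≡1
  ... | no γ≢1 = inj₂ (ℕP.≤∧≢⇒< γ≥1 (λ 1≡γ → γ≢1 (sym 1≡γ)) ,
                       completed-square (edgeCount G) n γ
                         (edge-inequality (edgeCount G) n k P γ edge-bound k+γ≡n 2P+γ≡γ²))

  min-degree-bound : MinDegree G 2 → n ≤ γ * γ × 2 * edgeCount G ≤ 3 * (γ * γ)
  min-degree-bound (deg≥2 , _) =
    vertex-inequality n k P γ outsider-bound k+γ≡n 2P+γ≡γ² ,
    edge-inequality-mindeg (edgeCount G) k P γ outsider-bound edge-bound 2P+γ≡γ²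
    where open MinimumDegreeTwo deg≥2
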